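{- Let $n$ be even and let $\pi$ be a fixed-point-free involution of $[n]$ chosen uniformly at random. Then ${\sf cut}(\pi)=\Omega(n)$ with probability at least $1-1/\sqrt{n}$.
   Context: For $1\le i\le n$, $C_i(\pi)$ is the set of transpositions $\{j,\pi(j)\}$ of $\pi$ with $\min(j,\pi(j))\le i\le\max(j,\pi(j))$, and ${\sf cut}(\pi)=\max_{1\le k\le n}|C_k(\pi)|$. -}

module Defs where

open import Data.Nat using (ℕ; zero; suc; _≤_; _<_; _⊔_; _≤?_; _<?_)
open import Data.Fin using (Fin; toℕ)
open import Data.Fin.Properties using (all?) renaming (_≟_ to _≟ᶠ_)
open import Data.Vec using (Vec; []; _∷_; lookup)
open import Data.List using (List; []; _∷_; map; concatMap; filter; length; allFin; foldr)
open import Data.Product using (_×_)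
open import Relation.Binary.PropositionalEquality using (_≡_; _≢_)
open import Relation.Nullary using (Dec; ¬_; ¬?)
open import Relation.Nullary.Decidable using (_×-dec_)

-- A map π : [n] → [n] is represented by Fin n → Fin n ([n] = {1..n} is
-- re-indexed as {0..n-1}; this changes nothing below).

allVecs : (m k : ℕ) → List (Vec (Fin m) k)
allVecs m zero = [] ∷ []
allVecs m (suc k) = concatMap (λ x → map (x ∷_) (allVecs m k)) (allFin m)

allMaps : (n : ℕ) → List (Fin n → Fin n)
allMaps n = map lookup (allVecs n n)

IsFPFInvolution : {n : ℕ} → (Fin n → Fin n) → Set
IsFPFInvolution {n} π = (∀ i → π (π i) ≡ i) × (∀ i → π i ≢ i)

isFPFInvolution? : {n : ℕ} → (π : Fin n → Fin n) → Dec (IsFPFInvolution π)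
isFPFInvolution? π =
  all? (λ i → π (π i) ≟ᶠ i) ×-dec all? (λ i → ¬? (π i ≟ᶠ i))

-- The (finite) sample space: all fixed-point-free involutions of [n].
fpfInvolutions : (n : ℕ) → List (Fin n → Fin n)
fpfInvolutions n = filter isFPFInvolution? (allMaps n)

-- |C_i(π)|: number of transpositions {j, π j} with min ≤ i ≤ max.
-- Each transposition {j, π j} (j ≠ π j) is counted once, via its smaller
-- element j < π j.
|C| : {n : ℕ} → (Fin n → Fin n) → Fin n → ℕ
|C| {n} π i = length (filter
  (λ j → (toℕ j <? toℕ (π j)) ×-dec ((toℕ j ≤? toℕ i) ×-dec (toℕ i ≤? toℕ (π j))))
  (allFin n))

cut : {n : ℕ} → (Fin n → Fin n) → ℕ
cut {n} π = foldr _⊔_ 0 (map (|C| π) (allFin n))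

-- Reading positions from left to right, each position either opens
-- an arc {i, π i} or closes one; a closing position is labelled by its rank among the
-- arcs open at that moment, which is below cut(π). This turns π into a labelled Dyck
-- word, and the word determines π (decoding sweeps from left to right). So with
-- w = ⌊n/64⌋ the involutions of small cut number at most #dyck(w, n), and
-- #dyck(w, n)² ≤ 4^n w^n. On the other side there are at least m! involutions of
-- [2m] (matchings i ↦ m + σ i for the permutations σ decoded from Lehmer codes), and
-- the weak Stirling bound m^m ≤ 4^m m! gives n · 4^n w^n ≤ (m!)².
module Submission where

open import Defs
open import Level using (0ℓ)
open import Data.Nat using (ℕ; zero; suc; _+_; _*_; _^_; _∸_; _≤_; _<_; z≤n; s≤s; z<s; _<?_; _≤?_; _⊔_; _!; ⌊_/2⌋; ⌈_/2⌉)
open import Data.Nat.Properties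
open import Data.Fin using (Fin; toℕ; fromℕ<; inject≤; _↑ˡ_; _↑ʳ_; splitAt; join)
open import Data.Fin.Properties using (toℕ-injective; toℕ<n; toℕ-fromℕ<; fromℕ<-toℕ; toℕ-inject≤; inject≤-injective; ↑ʳ-injective; splitAt-↑ˡ; splitAt-join; join-splitAt) renaming (_≟_ to _≟ᶠ_)
open import Data.Fin.Permutation using (Permutation′; _⟨$⟩ʳ_; _⟨$⟩ˡ_; inverseˡ; inverseʳ; _∘ₚ_; transpose) renaming (id to idₚ)
open import Data.List using (List; []; _∷_; _++_; [_]; length; filter; map; concatMap; cartesianProductWith; cartesianProduct; allFin; upTo; foldr)
open import Data.List.Properties using (length-++; length-map; length-upTo; length-tabulate; filter-none; ∷-injectiveˡ; ∷-injectiveʳ)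
open import Data.Vec using (Vec; lookup; tabulate) renaming ([] to []ᵛ; _∷_ to _∷ᵛ_)
open import Data.Vec.Properties using (tabulate∘lookup; lookup∘tabulate; tabulate-cong; ∷-injective)
open import Data.List.Membership.Propositional using (_∈_)
open import Data.List.Membership.Propositional.Properties using (∈-∃++; ∈-filter⁺; ∈-filter⁻; ∈-map⁺; ∈-map⁻; ∈-allFin; ∈-cartesianProductWith⁺; ∈-upTo⁺; ∈-++⁺ˡ; ∈-++⁺ʳ)
open import Data.List.Relation.Unary.Any using (here; there)
open import Data.List.Relation.Unary.All as All using (All)
import Data.List.Relation.Unary.All.Properties as All
open import Data.List.Relation.Unary.AllPairs using ([]; _∷_)
open import Data.List.Relation.Unary.Unique.Propositional using (Unique)
import Data.List.Relation.Unary.Unique.Propositional.Properties as Unique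
open import Data.List.Relation.Binary.Permutation.Propositional.Properties using (shift; ∈-resp-↭; ↭-length)
open import Data.List.Relation.Binary.Sublist.Propositional using (⊆-refl)
open import Data.List.Relation.Binary.Sublist.Propositional.Properties using (length-mono-≤) renaming (filter⁺ to sublist-filter⁺)
open import Data.Product using (Σ; _×_; _,_; proj₁; proj₂)
open import Data.Unit using (⊤; tt)
open import Data.Sum using (_⊎_; inj₁; inj₂)
open import Data.Empty using (⊥-elim)
open import Data.Nat.Tactic.RingSolver using (solve-∀)
open import Data.Nat.DivMod using (_/_; m*n/n≡m; m/n*n≤m; /-monoˡ-≤)
open import Data.Nat.Divisibility using (_∣_; divides)
open import Relation.Nullary using (¬_; Dec; yes; no; ¬?)
open import Relation.Nullary.Decidable using (_×-dec_; dec-true; dec-false)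
open import Relation.Unary using (Pred; Decidable)
open import Function using (_∘_)
open import Relation.Binary using (tri<; tri≈; tri>)
open import Relation.Binary.PropositionalEquality using (_≡_; _≢_; refl; sym; trans; cong; cong₂; subst; subst₂; module ≡-Reasoning)

unique-⊆-length : ∀ {A : Set} {xs ys : List A} →
  Unique xs → (∀ {x} → x ∈ xs → x ∈ ys) → length xs ≤ length ys
unique-⊆-length {xs = []} _ _ = z≤n
unique-⊆-length {xs = x ∷ xs} {ys} (x∉xs ∷ u) xs⊆ys with ∈-∃++ (xs⊆ys (here refl))
... | as , bs , refl = subst (suc (length xs) ≤_) (sym (↭-length (shift x as bs)))
  (s≤s (unique-⊆-length u λ {y} y∈xs →
    remove (∈-resp-↭ (shift x as bs) (xs⊆ys (there y∈xs))) (λ { refl → All.lookup x∉xs y∈xs refl })))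
  where
  remove : ∀ {y} → y ∈ x ∷ as ++ bs → y ≢ x → y ∈ as ++ bs
  remove (here y≡x) y≢x = ⊥-elim (y≢x y≡x)
  remove (there y∈) _   = y∈

∈⇒length-pos : ∀ {A : Set} {x : A} {xs : List A} → x ∈ xs → 1 ≤ length xs
∈⇒length-pos (here _)  = s≤s z≤n
∈⇒length-pos (there _) = s≤s z≤n

module _ {A : Set} {P Q : Pred A 0ℓ} (P? : Decidable P) (Q? : Decidable Q)
         (P⇒Q : ∀ {x} → P x → Q x) where

  Q∖P? : Decidable (λ x → Q x × ¬ P x)
  Q∖P? x = Q? x ×-dec ¬? (P? x)

  count-mono : ∀ xs → length (filter P? xs) ≤ length (filter Q? xs)
  count-mono xs = length-mono-≤ (sublist-filter⁺ P? Q? (λ { refl → P⇒Q }) (⊆-refl {x = xs}))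

  count-split : ∀ xs → length (filter Q? xs) ≡ length (filter P? xs) + length (filter Q∖P? xs)
  count-split [] = refl
  count-split (x ∷ xs) with P? x | Q? x
  ... | yes p | yes _ = cong suc (count-split xs)
  ... | yes p | no ¬q = ⊥-elim (¬q (P⇒Q p))
  ... | no _  | yes _ = trans (cong suc (count-split xs)) (sym (+-suc _ _))
  ... | no _  | no _  = count-split xs

  count-strict : ∀ {x} xs → x ∈ xs → Q x → ¬ P x → length (filter P? xs) < length (filter Q? xs)
  count-strict xs x∈ qx ¬px = subst (length (filter P? xs) <_) (sym (count-split xs))
    (m<m+n (length (filter P? xs)) (∈⇒length-pos (∈-filter⁺ Q∖P? x∈ (qx , ¬px))))

  count-suc : ∀ {x} xs → Unique xs → x ∈ xs → Q x → ¬ P x →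
    (∀ {z} → Q z → ¬ P z → z ≡ x) → length (filter Q? xs) ≡ suc (length (filter P? xs))
  count-suc {x} xs uxs x∈ qx ¬px only-x =
    trans (count-split xs) (trans (cong (length (filter P? xs) +_) one) (+-comm (length (filter P? xs)) 1))
    where
    one : length (filter Q∖P? xs) ≡ 1
    one = ≤-antisym
      (unique-⊆-length {ys = [ x ]} (Unique.filter⁺ Q∖P? uxs)
        λ z∈ → let (_ , qz , ¬pz) = ∈-filter⁻ Q∖P? {xs = xs} z∈ in here (only-x qz ¬pz))
      (∈⇒length-pos (∈-filter⁺ Q∖P? x∈ (qx , ¬px)))

injection-length : ∀ {A B : Set} {xs : List A} {ys : List B} (f : A → B) → Unique xs →
  (∀ {x y} → x ∈ xs → y ∈ xs → f x ≡ f y → x ≡ y) → (∀ {x} → x ∈ xs → f x ∈ ys) →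
  length xs ≤ length ys
injection-length {xs = xs} {ys} f uxs inj into =
  subst (_≤ length ys) (length-map f xs) (unique-⊆-length (map-unique uxs inj) image⊆ys)
  where
  image⊆ys : ∀ {y} → y ∈ map f xs → y ∈ ys
  image⊆ys y∈ with ∈-map⁻ f y∈
  ... | x , x∈ , refl = into x∈

  map-unique : ∀ {zs} → Unique zs → (∀ {x y} → x ∈ zs → y ∈ zs → f x ≡ f y → x ≡ y) → Unique (map f zs)
  map-unique [] _ = []
  map-unique {z ∷ zs} (z∉zs ∷ u) inj = All.tabulate fresh ∷ map-unique u (λ x∈ y∈ → inj (there x∈) (there y∈))
    where
    fresh : ∀ {y} → y ∈ map f zs → f z ≢ y
    fresh fy∈ with ∈-map⁻ f fy∈
    ... | y , y∈ , refl = λ fz≡fy → All.lookup z∉zs y∈ (inj (here refl) (there y∈) fz≡fy)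

concatMap-map≡cartesianProductWith : ∀ {A B C : Set} (f : A → B → C) (xs : List A) (ys : List B) →
  concatMap (λ x → map (f x) ys) xs ≡ cartesianProductWith f xs ys
concatMap-map≡cartesianProductWith f []       ys = refl
concatMap-map≡cartesianProductWith f (x ∷ xs) ys = cong (map (f x) ys ++_) (concatMap-map≡cartesianProductWith f xs ys)

length-cartesianProductWith : ∀ {A B C : Set} (f : A → B → C) (xs : List A) (ys : List B) →
  length (cartesianProductWith f xs ys) ≡ length xs * length ys
length-cartesianProductWith f []       ys = refl
length-cartesianProductWith f (x ∷ xs) ys = trans (length-++ (map (f x) ys))
  (cong₂ _+_ (length-map (f x) ys) (length-cartesianProductWith f xs ys))

allVecs-complete : ∀ m k (v : Vec (Fin m) k) → v ∈ allVecs m k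
allVecs-complete m zero []ᵛ = here refl
allVecs-complete m (suc k) (x ∷ᵛ v) =
  subst ((x ∷ᵛ v) ∈_) (sym (concatMap-map≡cartesianProductWith _∷ᵛ_ (allFin m) (allVecs m k)))
    (∈-cartesianProductWith⁺ _∷ᵛ_ (∈-allFin x) (allVecs-complete m k v))

allVecs-unique : ∀ m k → Unique (allVecs m k)
allVecs-unique m zero = All.[] ∷ []
allVecs-unique m (suc k) =
  subst Unique (sym (concatMap-map≡cartesianProductWith _∷ᵛ_ (allFin m) (allVecs m k)))
    (Unique.cartesianProductWith⁺ _∷ᵛ_ ∷-injective (Unique.allFin⁺ m) (allVecs-unique m k))

lookup-≗-injective : ∀ {n} {A : Set} {v w : Vec A n} → (∀ i → lookup v i ≡ lookup w i) → v ≡ w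
lookup-≗-injective {v = v} {w} v≗w = begin
  v                  ≡⟨ tabulate∘lookup v ⟨
  tabulate (lookup v) ≡⟨ tabulate-cong v≗w ⟩
  tabulate (lookup w) ≡⟨ tabulate∘lookup w ⟩
  w                  ∎
  where open ≡-Reasoning

fpf-resp-≗ : ∀ {n} {π σ : Fin n → Fin n} → (∀ i → π i ≡ σ i) → IsFPFInvolution π → IsFPFInvolution σ
fpf-resp-≗ {π = π} {σ} π≗σ (invol , no-fix) =
  (λ i → trans (cong σ (sym (π≗σ i))) (trans (sym (π≗σ (π i))) (invol i))) ,
  (λ i σi≡i → no-fix i (trans (π≗σ i) σi≡i))

fpfInvolutions-unique : ∀ n → Unique (fpfInvolutions n)
fpfInvolutions-unique n = Unique.filter⁺ isFPFInvolution?
  (Unique.map⁺ (λ {v} {w} e → lookup-≗-injective {v = v} {w} (λ i → cong (λ f → f i) e)) (allVecs-unique n n))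

∈-fpfInvolutions⁺ : ∀ {n} (v : Vec (Fin n) n) → IsFPFInvolution (lookup v) → lookup v ∈ fpfInvolutions n
∈-fpfInvolutions⁺ {n} v fpf = ∈-filter⁺ isFPFInvolution? (∈-map⁺ lookup (allVecs-complete n n v)) fpf

∈-fpfInvolutions⁻ : ∀ {n} {π : Fin n → Fin n} → π ∈ fpfInvolutions n →
  (Σ (Vec (Fin n) n) λ v → π ≡ lookup v) × IsFPFInvolution π
∈-fpfInvolutions⁻ {n} π∈ with ∈-filter⁻ isFPFInvolution? {xs = allMaps n} π∈
... | π∈allMaps , fpf with ∈-map⁻ lookup π∈allMaps
...   | v , _ , π≡v = (v , π≡v) , fpf

count-by-family : ∀ {n} (D : List (Vec (Fin n) n)) → Unique D →
  All (λ v → IsFPFInvolution (lookup v)) D → length D ≤ length (fpfInvolutions n)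
count-by-family D uD fpfD = injection-length lookup uD
  (λ {v} {w} _ _ e → lookup-≗-injective {v = v} {w} (λ i → cong (λ f → f i) e))
  (λ {v} v∈ → ∈-fpfInvolutions⁺ v (All.lookup fpfD v∈))

count-by-encoding : ∀ {n} {B : Set} {P : Pred (Fin n → Fin n) 0ℓ} (P? : Decidable P)
  (enc : (Fin n → Fin n) → B) (C : List B) →
  (∀ {π σ} → IsFPFInvolution π → IsFPFInvolution σ → enc π ≡ enc σ → ∀ i → π i ≡ σ i) →
  (∀ {π} → IsFPFInvolution π → P π → enc π ∈ C) →
  length (filter P? (fpfInvolutions n)) ≤ length C
count-by-encoding {n} {P = P} P? enc C enc-injective enc-into =
  injection-length enc (Unique.filter⁺ P? (fpfInvolutions-unique n)) injective into
  where
  member : ∀ {π} → π ∈ filter P? (fpfInvolutions n) →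
    ((Σ (Vec (Fin n) n) λ v → π ≡ lookup v) × IsFPFInvolution π) × P π
  member π∈ with ∈-filter⁻ P? {xs = fpfInvolutions n} π∈
  ... | π∈F , pπ = ∈-fpfInvolutions⁻ π∈F , pπ

  injective : ∀ {π σ} → π ∈ filter P? (fpfInvolutions n) → σ ∈ filter P? (fpfInvolutions n) →
    enc π ≡ enc σ → π ≡ σ
  injective π∈ σ∈ e with member π∈ | member σ∈
  ... | ((v , refl) , fπ) , _ | ((w , refl) , fσ) , _ =
    cong lookup (lookup-≗-injective {v = v} {w} (enc-injective fπ fσ e))

  into : ∀ {π} → π ∈ filter P? (fpfInvolutions n) → enc π ∈ C
  into π∈ with member π∈
  ... | (_ , fπ) , pπ = enc-into fπ pπ

-- Labelled Dyck words: dyckWords w k o lists the words of length k that, starting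
-- with o open arcs, end with none open; the letter 0 opens an arc and a letter 1 + r
-- with r < w closes one (the label r says which of the open arcs is closed).
dyckWords : ℕ → ℕ → ℕ → List (List ℕ)
dyckWords w zero    zero    = [] ∷ []
dyckWords w zero    (suc o) = []
dyckWords w (suc k) zero    = map (0 ∷_) (dyckWords w k 1)
dyckWords w (suc k) (suc o) =
  map (0 ∷_) (dyckWords w k (suc (suc o))) ++ cartesianProductWith (λ r → suc r ∷_) (upTo w) (dyckWords w k o)

dyck-open : ∀ {w k o rest} → rest ∈ dyckWords w k (suc o) → (0 ∷ rest) ∈ dyckWords w (suc k) o
dyck-open {o = zero}  rest∈ = ∈-map⁺ (0 ∷_) rest∈
dyck-open {o = suc o} rest∈ = ∈-++⁺ˡ (∈-map⁺ (0 ∷_) rest∈)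

dyck-close : ∀ {w k o r rest} → r < w → rest ∈ dyckWords w k o → (suc r ∷ rest) ∈ dyckWords w (suc k) (suc o)
dyck-close {w} {k} {o} r<w rest∈ = ∈-++⁺ʳ (map (0 ∷_) (dyckWords w k (suc (suc o))))
  (∈-cartesianProductWith⁺ (λ r → suc r ∷_) (∈-upTo⁺ r<w) rest∈)

-- (a + b)² ≤ 2a² + 2b², since the two sides differ by (b − a)².
square-of-sum-ordered : ∀ {a b} → a ≤ b → (a + b) * (a + b) ≤ 2 * (a * a) + 2 * (b * b)
square-of-sum-ordered {a} {b} a≤b with b ∸ a | m+[n∸m]≡n a≤b
... | d | refl = subst ((a + (a + d)) * (a + (a + d)) ≤_) (identity a d) (m≤m+n _ (d * d))
  where
  identity : ∀ a d → (a + (a + d)) * (a + (a + d)) + d * d ≡ 2 * (a * a) + 2 * ((a + d) * (a + d))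
  identity = solve-∀

square-of-sum : ∀ a b → (a + b) * (a + b) ≤ 2 * (a * a) + 2 * (b * b)
square-of-sum a b with ≤-total a b
... | inj₁ a≤b = square-of-sum-ordered a≤b
... | inj₂ b≤a = subst₂ _≤_ (cong (λ x → x * x) (+-comm b a)) (+-comm (2 * (b * b)) (2 * (a * a)))
                   (square-of-sum-ordered b≤a)

#dyck : ℕ → ℕ → ℕ → ℕ
#dyck w k o = length (dyckWords w k o)

#dyck-step : ∀ w k o → #dyck w (suc k) (suc o) ≡ #dyck w k (suc (suc o)) + w * #dyck w k o
#dyck-step w k o = trans (length-++ (map (0 ∷_) (dyckWords w k (suc (suc o)))))
  (cong₂ _+_ (length-map (0 ∷_) (dyckWords w k (suc (suc o))))
             (trans (length-cartesianProductWith (λ r → suc r ∷_) (upTo w) (dyckWords w k o))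
                    (cong (_* #dyck w k o) (length-upTo w))))

-- #dyck(k, o)² ≤ 4^k w^(k+o): by induction, using (a + wb)² ≤ 2a² + 2w²b² at a closing
-- step; in effect at most 2^k shapes and (k + o)/2 labels below w.
#dyck-bound : ∀ w k o → #dyck w k o * #dyck w k o ≤ 4 ^ k * w ^ (k + o)
#dyck-bound w zero    zero    = ≤-refl
#dyck-bound w zero    (suc o) = z≤n
#dyck-bound w (suc k) zero    = begin
  #dyck w (suc k) 0 * #dyck w (suc k) 0 ≡⟨ cong (λ c → c * c) (length-map (0 ∷_) (dyckWords w k 1)) ⟩
  #dyck w k 1 * #dyck w k 1             ≤⟨ #dyck-bound w k 1 ⟩
  4 ^ k * w ^ (k + 1)                   ≡⟨ cong (λ e → 4 ^ k * w ^ e) (trans (+-comm k 1) (sym (+-identityʳ (suc k)))) ⟩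
  4 ^ k * w ^ (suc k + 0)               ≤⟨ m≤n*m (4 ^ k * w ^ (suc k + 0)) 4 ⟩
  4 * (4 ^ k * w ^ (suc k + 0))         ≡⟨ *-assoc 4 (4 ^ k) (w ^ (suc k + 0)) ⟨
  4 ^ suc k * w ^ (suc k + 0)           ∎
  where open ≤-Reasoning
#dyck-bound w (suc k) (suc o) = begin
  #dyck w (suc k) (suc o) * #dyck w (suc k) (suc o) ≡⟨ cong (λ c → c * c) (#dyck-step w k o) ⟩
  (A + w * B) * (A + w * B)                         ≤⟨ square-of-sum A (w * B) ⟩
  2 * (A * A) + 2 * (w * B * (w * B))               ≤⟨ +-mono-≤ (*-monoʳ-≤ 2 A²≤) (*-monoʳ-≤ 2 wB²≤) ⟩
  2 * (w * w * X) + 2 * (w * w * X)                 ≡⟨ combine w (4 ^ k) (w ^ (k + o)) ⟩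
  4 ^ suc k * (w * (w * w ^ (k + o)))               ≡⟨ cong (λ e → 4 ^ suc k * w ^ e) (sym (cong suc (+-suc k o))) ⟩
  4 ^ suc k * w ^ (suc k + suc o)                   ∎
  where
  open ≤-Reasoning
  A = #dyck w k (suc (suc o))
  B = #dyck w k o
  X = 4 ^ k * w ^ (k + o)
  two-more : w ^ (k + suc (suc o)) ≡ w * w * w ^ (k + o)
  two-more = trans (cong (w ^_) (trans (+-suc k (suc o)) (cong suc (+-suc k o))))
                   (sym (*-assoc w w (w ^ (k + o))))
  A²≤ : A * A ≤ w * w * X
  A²≤ = subst (A * A ≤_) (trans (cong (4 ^ k *_) two-more) (regroup w (4 ^ k) (w ^ (k + o))))
              (#dyck-bound w k (suc (suc o)))
    where
    regroup : ∀ w a x → a * (w * w * x) ≡ w * w * (a * x)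
    regroup = solve-∀
  wB²≤ : w * B * (w * B) ≤ w * w * X
  wB²≤ = subst (_≤ w * w * X) (regroup w B) (*-monoʳ-≤ (w * w) (#dyck-bound w k o))
    where
    regroup : ∀ w b → w * w * (b * b) ≡ w * b * (w * b)
    regroup = solve-∀
  combine : ∀ w a x → 2 * (w * w * (a * x)) + 2 * (w * w * (a * x)) ≡ 4 * a * (w * (w * x))
  combine = solve-∀

≤-foldr-⊔ : ∀ {x} xs → x ∈ xs → x ≤ foldr _⊔_ 0 xs
≤-foldr-⊔ (y ∷ ys) (here refl) = m≤m⊔n y (foldr _⊔_ 0 ys)
≤-foldr-⊔ (y ∷ ys) (there x∈)  = ≤-trans (≤-foldr-⊔ ys x∈) (m≤n⊔m y (foldr _⊔_ 0 ys))

-- Arcs of a map π. Position i opens its arc {i, π i} when its partner lies to the right.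
Opens : ∀ {n} → (Fin n → Fin n) → Fin n → Set
Opens π i = toℕ i < toℕ (π i)

-- The arc of j spans the gap just before position t.
Spans : ∀ {n} → (Fin n → Fin n) → ℕ → Fin n → Set
Spans π t j = toℕ j < t × t ≤ toℕ (π j)

spans? : ∀ {n} (π : Fin n → Fin n) (t : ℕ) → Decidable (Spans π t)
spans? π t j = (toℕ j <? t) ×-dec (t ≤? toℕ (π j))

openArcs : ∀ {n} → (Fin n → Fin n) → ℕ → ℕ
openArcs {n} π t = length (filter (spans? π t) (allFin n))

-- For a closing position i: the arc of j is still open at i and was opened before
-- the partner π i.
Nested : ∀ {n} → (Fin n → Fin n) → Fin n → Fin n → Set
Nested π i j = toℕ j < toℕ (π i) × toℕ i < toℕ (π j)

nested? : ∀ {n} (π : Fin n → Fin n) (i : Fin n) → Decidable (Nested π i)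
nested? π i j = (toℕ j <? toℕ (π i)) ×-dec (toℕ i <? toℕ (π j))

-- The rank of a closing position: which of the open arcs it closes.
rank : ∀ {n} → (Fin n → Fin n) → Fin n → ℕ
rank {n} π i = length (filter (nested? π i) (allFin n))

code : ∀ {n} → (Fin n → Fin n) → Fin n → ℕ
code π i with toℕ i <? toℕ (π i)
... | yes _ = 0
... | no _  = suc (rank π i)

code-opens : ∀ {n} (π : Fin n → Fin n) {i} → Opens π i → code π i ≡ 0
code-opens π {i} opens with toℕ i <? toℕ (π i)
... | yes _      = refl
... | no ¬opens = ⊥-elim (¬opens opens)

code-closes : ∀ {n} (π : Fin n → Fin n) {i} → ¬ Opens π i → code π i ≡ suc (rank π i)
code-closes π {i} ¬opens with toℕ i <? toℕ (π i)
... | yes opens = ⊥-elim (¬opens opens)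
... | no _      = refl

openArcs-start : ∀ {n} (π : Fin n → Fin n) → openArcs π 0 ≡ 0
openArcs-start {n} π =
  cong length (filter-none (spans? π 0) {xs = allFin n} (All.tabulate λ _ → λ { (() , _) }))

openArcs-end : ∀ {n} (π : Fin n → Fin n) → openArcs π n ≡ 0
openArcs-end {n} π = cong length (filter-none (spans? π n) {xs = allFin n}
  (All.tabulate λ {j} _ (_ , n≤πj) → <⇒≱ (toℕ<n (π j)) n≤πj))

-- Every arc open at i belongs to C_i, so openArcs π i ≤ |C_i(π)| ≤ cut(π).
openArcs≤cut : ∀ {n} (π : Fin n → Fin n) (i : Fin n) → openArcs π (toℕ i) ≤ cut π
openArcs≤cut {n} π i = ≤-trans
  (count-mono (spans? π (toℕ i))
    (λ j → (toℕ j <? toℕ (π j)) ×-dec ((toℕ j ≤? toℕ i) ×-dec (toℕ i ≤? toℕ (π j))))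
    (λ (j<i , i≤πj) → <-≤-trans j<i i≤πj , <⇒≤ j<i , i≤πj) (allFin n))
  (≤-foldr-⊔ (map (|C| π) (allFin n)) (∈-map⁺ (|C| π) (∈-allFin i)))

module _ {n : ℕ} {π : Fin n → Fin n} (fpf : IsFPFInvolution π) where

  partner : ∀ {i j} → π j ≡ i → j ≡ π i
  partner {j = j} refl = sym (proj₁ fpf j)

  closes-left : ∀ {i} → ¬ Opens π i → toℕ (π i) < toℕ i
  closes-left {i} ¬opens = ≤∧≢⇒< (≮⇒≥ ¬opens) (λ e → proj₂ fpf i (toℕ-injective e))

  ends-at : ∀ {i j} → toℕ (π j) ≡ toℕ i → j ≡ π i
  ends-at e = partner (toℕ-injective e)

  spans-past-opener : ∀ {i j} → Opens π i → Spans π (toℕ i) j → toℕ i < toℕ (π j)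
  spans-past-opener {i} opens (j<i , i≤πj) = ≤∧≢⇒< i≤πj
    (λ i≡πj → <-asym j<i (subst (λ k → toℕ i < toℕ k) (sym (ends-at (sym i≡πj))) opens))

  spans-past-closer : ∀ {i j} → Spans π (toℕ i) j → j ≢ π i → toℕ i < toℕ (π j)
  spans-past-closer (_ , i≤πj) j≢πi = ≤∧≢⇒< i≤πj (λ i≡πj → j≢πi (ends-at (sym i≡πj)))

  openArcs-opens : ∀ {i} → Opens π i → openArcs π (suc (toℕ i)) ≡ suc (openArcs π (toℕ i))
  openArcs-opens {i} opens = count-suc (spans? π (toℕ i)) (spans? π (suc (toℕ i)))
    (λ sp → m<n⇒m<1+n (proj₁ sp) , spans-past-opener opens sp)
    (allFin n) (Unique.allFin⁺ n) (∈-allFin i) (≤-refl , opens) (λ (i<i , _) → <-irrefl refl i<i) new-is-i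
    where
    new-is-i : ∀ {j} → Spans π (suc (toℕ i)) j → ¬ Spans π (toℕ i) j → j ≡ i
    new-is-i {j} (j<i+1 , i<πj) ¬old with m<1+n⇒m<n∨m≡n j<i+1
    ... | inj₁ j<i = ⊥-elim (¬old (j<i , <⇒≤ i<πj))
    ... | inj₂ j≡i = toℕ-injective j≡i

  openArcs-closes : ∀ {i} → ¬ Opens π i → openArcs π (toℕ i) ≡ suc (openArcs π (suc (toℕ i)))
  openArcs-closes {i} ¬opens = count-suc (spans? π (suc (toℕ i))) (spans? π (toℕ i)) was-open
    (allFin n) (Unique.allFin⁺ n) (∈-allFin (π i)) partner-spans
    (λ (_ , i<ππi) → <-irrefl (cong toℕ (sym (proj₁ fpf i))) i<ππi) closed-is-partner
    where
    partner-spans : Spans π (toℕ i) (π i)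
    partner-spans = closes-left ¬opens , ≤-reflexive (cong toℕ (sym (proj₁ fpf i)))
    was-open : ∀ {j} → Spans π (suc (toℕ i)) j → Spans π (toℕ i) j
    was-open {j} (j<i+1 , i<πj) with m<1+n⇒m<n∨m≡n j<i+1
    ... | inj₁ j<i = j<i , <⇒≤ i<πj
    ... | inj₂ j≡i = ⊥-elim (¬opens (subst (λ k → toℕ i < toℕ (π k)) (toℕ-injective j≡i) i<πj))
    closed-is-partner : ∀ {j} → Spans π (toℕ i) j → ¬ Spans π (suc (toℕ i)) j → j ≡ π i
    closed-is-partner {j} sp ¬still with j ≟ᶠ π i
    ... | yes j≡πi = j≡πi
    ... | no  j≢πi = ⊥-elim (¬still (m<n⇒m<1+n (proj₁ sp) , spans-past-closer sp j≢πi))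

  -- The rank of a closing position is smaller than the number of arcs open there:
  -- every nested arc is open, and so is the arc being closed, which is not nested.
  rank<openArcs : ∀ {i} → ¬ Opens π i → rank π i < openArcs π (toℕ i)
  rank<openArcs {i} ¬opens = count-strict (nested? π i) (spans? π (toℕ i))
    (λ (j<πi , i<πj) → <-trans j<πi (closes-left ¬opens) , <⇒≤ i<πj)
    (allFin n) (∈-allFin (π i)) (closes-left ¬opens , ≤-reflexive (cong toℕ (sym (proj₁ fpf i))))
    (λ (πi<πi , _) → <-irrefl refl πi<πi)

-- The letter at a position given as a natural number (0 past the end).
codeAt : ∀ {n} → (Fin n → Fin n) → ℕ → ℕ
codeAt {n} π t with t <? n
... | yes t<n = code π (fromℕ< t<n)
... | no _    = 0

codeAt-fromℕ< : ∀ {n} (π : Fin n → Fin n) {t} (t<n : t < n) → codeAt π t ≡ code π (fromℕ< t<n)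
codeAt-fromℕ< {n} π {t} t<n with t <? n
... | yes _   = refl
... | no t≮n = ⊥-elim (t≮n t<n)

codeAt-toℕ : ∀ {n} (π : Fin n → Fin n) (i : Fin n) → codeAt π (toℕ i) ≡ code π i
codeAt-toℕ π i = trans (codeAt-fromℕ< π (toℕ<n i)) (cong (code π) (fromℕ<-toℕ i (toℕ<n i)))

codeWord : ∀ {n} → (Fin n → Fin n) → ℕ → ℕ → List ℕ
codeWord π t zero    = []
codeWord π t (suc k) = codeAt π t ∷ codeWord π (suc t) k

encode : ∀ {n} → (Fin n → Fin n) → List ℕ
encode {n} π = codeWord π 0 n

module _ {n : ℕ} {π : Fin n → Fin n} (fpf : IsFPFInvolution π) {w : ℕ} (cut≤w : cut π ≤ w) where

  letter-dyck : ∀ {k rest} i → rest ∈ dyckWords w k (openArcs π (suc (toℕ i))) →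
    (code π i ∷ rest) ∈ dyckWords w (suc k) (openArcs π (toℕ i))
  letter-dyck {k} {rest} i rest∈ = by-cases (toℕ i <? toℕ (π i))
    where
    by-cases : Dec (Opens π i) → (code π i ∷ rest) ∈ dyckWords w (suc k) (openArcs π (toℕ i))
    by-cases (yes opens) = subst (λ c → (c ∷ rest) ∈ dyckWords w (suc k) (openArcs π (toℕ i)))
      (sym (code-opens π opens))
      (dyck-open {w} {k} {openArcs π (toℕ i)}
        (subst (λ o → rest ∈ dyckWords w k o) (openArcs-opens fpf opens) rest∈))
    by-cases (no ¬opens) = subst₂ (λ c o → (c ∷ rest) ∈ dyckWords w (suc k) o)
      (sym (code-closes π ¬opens)) (sym (openArcs-closes fpf ¬opens))
      (dyck-close {w} {k} {openArcs π (suc (toℕ i))} rank<w rest∈)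
      where
      rank<w : rank π i < w
      rank<w = <-≤-trans (rank<openArcs fpf ¬opens) (≤-trans (openArcs≤cut π i) cut≤w)

  codeWord-dyck : ∀ k t → t + k ≡ n → codeWord π t k ∈ dyckWords w k (openArcs π t)
  codeWord-dyck zero t t+0≡n = subst (λ o → [] ∈ dyckWords w 0 o) (sym none-open) (here refl)
    where
    none-open : openArcs π t ≡ 0
    none-open = trans (cong (openArcs π) (trans (sym (+-identityʳ t)) t+0≡n)) (openArcs-end π)
  codeWord-dyck (suc k) t t+k+1≡n =
    subst (λ c → (c ∷ codeWord π (suc t) k) ∈ dyckWords w (suc k) (openArcs π t))
      (sym (codeAt-fromℕ< π t<n))
      (at (fromℕ< t<n) (toℕ-fromℕ< t<n) (codeWord-dyck k (suc t) (trans (sym (+-suc t k)) t+k+1≡n)))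
    where
    t<n : t < n
    t<n = subst (t <_) t+k+1≡n (m<m+n t z<s)
    at : ∀ {s rest} i → toℕ i ≡ s → rest ∈ dyckWords w k (openArcs π (suc s)) →
      (code π i ∷ rest) ∈ dyckWords w (suc k) (openArcs π s)
    at i refl = letter-dyck i

  encode-dyck : encode π ∈ dyckWords w n 0
  encode-dyck = subst (λ o → encode π ∈ dyckWords w n o) (openArcs-start π) (codeWord-dyck n 0 refl)

codeWord-letters : ∀ {n} (π σ : Fin n → Fin n) t k → codeWord π t k ≡ codeWord σ t k →
  ∀ {p} → t ≤ p → p < t + k → codeAt π p ≡ codeAt σ p
codeWord-letters π σ t zero    _ t≤p p<t+0 =
  ⊥-elim (<⇒≱ p<t+0 (subst (_≤ _) (sym (+-identityʳ t)) t≤p))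
codeWord-letters π σ t (suc k) e {p} t≤p p<t+k+1 with m≤n⇒m<n∨m≡n t≤p
... | inj₂ refl = ∷-injectiveˡ e
... | inj₁ t<p  =
  codeWord-letters π σ (suc t) k (∷-injectiveʳ e) t<p (subst (p <_) (+-suc t k) p<t+k+1)

encode-letters : ∀ {n} (π σ : Fin n → Fin n) → encode π ≡ encode σ → ∀ i → code π i ≡ code σ i
encode-letters {n} π σ e i = begin
  code π i          ≡⟨ codeAt-toℕ π i ⟨
  codeAt π (toℕ i)  ≡⟨ codeWord-letters π σ 0 n e z≤n (toℕ<n i) ⟩
  codeAt σ (toℕ i)  ≡⟨ codeAt-toℕ σ i ⟩
  code σ i          ∎
  where open ≡-Reasoning

sweep : ∀ {n} (Q : ℕ → Set) → Q 0 → (∀ (i : Fin n) → Q (toℕ i) → Q (suc (toℕ i))) → Q n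
sweep {n} Q q₀ step = upto n ≤-refl
  where
  upto : ∀ t → t ≤ n → Q t
  upto zero    _   = q₀
  upto (suc t) t<n = subst (λ s → Q (suc s)) (toℕ-fromℕ< t<n)
    (step (fromℕ< t<n) (subst Q (sym (toℕ-fromℕ< t<n)) (upto t (<⇒≤ t<n))))

-- π and σ agree on every arc closed before the gap t and leave the same positions
-- open there.
AgreeBefore : ∀ {n} → (π σ : Fin n → Fin n) → ℕ → Set
AgreeBefore π σ t = ∀ j → toℕ j < t → π j ≡ σ j ⊎ (t ≤ toℕ (π j) × t ≤ toℕ (σ j))

AgreeBefore-sym : ∀ {n} {π σ : Fin n → Fin n} {t} → AgreeBefore π σ t → AgreeBefore σ π t
AgreeBefore-sym agree j j<t with agree j j<t
... | inj₁ πj≡σj            = inj₁ (sym πj≡σj)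
... | inj₂ (t≤πj , t≤σj) = inj₂ (t≤σj , t≤πj)

-- If π and σ agree before a closing position i of π, and the arc π closes at i is
-- still open in σ and opens before σ's partner of i, then π ranks i strictly lower:
-- every arc nested for π is nested for σ, and so is π's own partner of i.
rank-compare : ∀ {n} {π σ : Fin n → Fin n} → IsFPFInvolution π → IsFPFInvolution σ → ∀ {i} →
  AgreeBefore π σ (toℕ i) → toℕ (π i) < toℕ i → toℕ (π i) < toℕ (σ i) → toℕ i ≤ toℕ (σ (π i)) →
  rank π i < rank σ i
rank-compare {n} {π} {σ} fπ fσ {i} agree πi<i πi<σi i≤σπi =
  count-strict (nested? π i) (nested? σ i) nested-in-σ (allFin n) (∈-allFin (π i))
    (πi<σi , ≤∧≢⇒< i≤σπi (λ i≡σπi → <-irrefl (cong toℕ (ends-at fσ (sym i≡σπi))) πi<σi))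
    (λ (πi<πi , _) → <-irrefl refl πi<πi)
  where
  nested-in-σ : ∀ {j} → Nested π i j → Nested σ i j
  nested-in-σ {j} (j<πi , i<πj) with agree j (<-trans j<πi πi<i)
  ... | inj₁ πj≡σj     = <-trans j<πi πi<σi , subst (λ k → toℕ i < toℕ k) πj≡σj i<πj
  ... | inj₂ (_ , i≤σj) = <-trans j<πi πi<σi ,
    spans-past-closer fσ (<-trans j<πi πi<i , i≤σj)
      (λ j≡σi → <-asym j<πi (subst (λ k → toℕ (π i) < toℕ k) (sym j≡σi) πi<σi))

-- Sweeping from left to
-- right, the letter of i says whether i opens an arc; if it closes one, the rank
-- singles out the arc among those open, which both maps share by induction.
module _ {n : ℕ} {π σ : Fin n → Fin n} (fπ : IsFPFInvolution π) (fσ : IsFPFInvolution σ)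
         (same-code : ∀ i → code π i ≡ code σ i) where

  opens-σ : ∀ {i} → Opens π i → Opens σ i
  opens-σ {i} opens with toℕ i <? toℕ (σ i)
  ... | yes σ-opens = σ-opens
  ... | no ¬σ-opens =
    ⊥-elim (0≢1+n (trans (sym (code-opens π opens)) (trans (same-code i) (code-closes σ ¬σ-opens))))

  closes-σ : ∀ {i} → ¬ Opens π i → ¬ Opens σ i
  closes-σ {i} ¬opens σ-opens =
    0≢1+n (trans (sym (code-opens σ σ-opens)) (trans (sym (same-code i)) (code-closes π ¬opens)))

  same-rank : ∀ {i} → ¬ Opens π i → rank π i ≡ rank σ i
  same-rank {i} ¬opens = suc-injective
    (trans (sym (code-closes π ¬opens)) (trans (same-code i) (code-closes σ (closes-σ ¬opens))))

  -- At a closing position both maps close the same arc: otherwise the one whose arc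
  -- opened earlier would give i the smaller rank.
  partners-agree : ∀ {i} → ¬ Opens π i → AgreeBefore π σ (toℕ i) → π i ≡ σ i
  partners-agree {i} ¬opens agree
    with agree (π i) (closes-left fπ ¬opens) | agree (σ i) (closes-left fσ (closes-σ ¬opens))
  ... | inj₁ ππi≡σπi | _ = partner fσ (trans (sym ππi≡σπi) (proj₁ fπ i))
  ... | _ | inj₁ πσi≡σσi = sym (partner fπ (trans πσi≡σσi (proj₁ fσ i)))
  ... | inj₂ (_ , i≤σπi) | inj₂ (i≤πσi , _) with <-cmp (toℕ (π i)) (toℕ (σ i))
  ...   | tri< πi<σi _ _ = ⊥-elim (<-irrefl (same-rank ¬opens)
                             (rank-compare fπ fσ agree (closes-left fπ ¬opens) πi<σi i≤σπi))
  ...   | tri≈ _ πi≡σi _ = toℕ-injective πi≡σi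
  ...   | tri> _ _ σi<πi = ⊥-elim (<-irrefl (sym (same-rank ¬opens))
                             (rank-compare fσ fπ (AgreeBefore-sym agree) (closes-left fσ (closes-σ ¬opens))
                                           σi<πi i≤πσi))

  agree-step-opens : ∀ {i} → Opens π i → AgreeBefore π σ (toℕ i) → AgreeBefore π σ (suc (toℕ i))
  agree-step-opens {i} opens agree j j<i+1 with m<1+n⇒m<n∨m≡n j<i+1
  ... | inj₂ j≡i rewrite toℕ-injective j≡i = inj₂ (opens , opens-σ opens)
  ... | inj₁ j<i with agree j j<i
  ...   | inj₁ πj≡σj            = inj₁ πj≡σj
  ...   | inj₂ (i≤πj , i≤σj) =
    inj₂ (spans-past-opener fπ opens (j<i , i≤πj) , spans-past-opener fσ (opens-σ opens) (j<i , i≤σj))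

  agree-step-closes : ∀ {i} → ¬ Opens π i → AgreeBefore π σ (toℕ i) → AgreeBefore π σ (suc (toℕ i))
  agree-step-closes {i} ¬opens agree = past (partners-agree ¬opens agree)
    where
    past : π i ≡ σ i → AgreeBefore π σ (suc (toℕ i))
    past πi≡σi j j<i+1 with m<1+n⇒m<n∨m≡n j<i+1
    ... | inj₂ j≡i rewrite toℕ-injective j≡i = inj₁ πi≡σi
    ... | inj₁ j<i with agree j j<i
    ...   | inj₁ πj≡σj            = inj₁ πj≡σj
    ...   | inj₂ (i≤πj , i≤σj) with j ≟ᶠ π i
    ...     | yes refl = inj₁ (trans (proj₁ fπ i) (sym (trans (cong σ πi≡σi) (proj₁ fσ i))))
    ...     | no j≢πi  = inj₂ (spans-past-closer fπ (j<i , i≤πj) j≢πi ,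
                               spans-past-closer fσ (j<i , i≤σj) (λ j≡σi → j≢πi (trans j≡σi (sym πi≡σi))))

  agree-step : ∀ i → AgreeBefore π σ (toℕ i) → AgreeBefore π σ (suc (toℕ i))
  agree-step i with toℕ i <? toℕ (π i)
  ... | yes opens = agree-step-opens opens
  ... | no ¬opens = agree-step-closes ¬opens

  -- After the last position nothing is open, so the two maps agree everywhere.
  code-injective : ∀ i → π i ≡ σ i
  code-injective i with sweep (AgreeBefore π σ) (λ _ ()) agree-step i (toℕ<n i)
  ... | inj₁ πi≡σi       = πi≡σi
  ... | inj₂ (n≤πi , _) = ⊥-elim (<⇒≱ (toℕ<n (π i)) n≤πi)

transpose-at : ∀ {m} (i j : Fin m) → transpose i j ⟨$⟩ʳ i ≡ j
transpose-at i j rewrite dec-true (i ≟ᶠ i) refl = refl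

transpose-elsewhere : ∀ {m} {i j x : Fin m} → x ≢ i → x ≢ j → transpose i j ⟨$⟩ʳ x ≡ x
transpose-elsewhere {i = i} {j} {x} x≢i x≢j
  rewrite dec-false (x ≟ᶠ i) x≢i | dec-false (x ≟ᶠ j) x≢j = refl

cross : ∀ {m} → Permutation′ m → Fin m ⊎ Fin m → Fin m ⊎ Fin m
cross σ (inj₁ p) = inj₂ (σ ⟨$⟩ʳ p)
cross σ (inj₂ q) = inj₁ (σ ⟨$⟩ˡ q)

cross-involutive : ∀ {m} (σ : Permutation′ m) s → cross σ (cross σ s) ≡ s
cross-involutive σ (inj₁ p) = cong inj₁ (inverseˡ σ)
cross-involutive σ (inj₂ q) = cong inj₂ (inverseʳ σ)

cross-no-fixed-point : ∀ {m} (σ : Permutation′ m) s → cross σ s ≢ s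
cross-no-fixed-point σ (inj₁ p) ()
cross-no-fixed-point σ (inj₂ q) ()

matching : ∀ {m} → Permutation′ m → Fin (m + m) → Fin (m + m)
matching {m} σ x = join m m (cross σ (splitAt m x))

-- Transported along the bijection splitAt/join, cross is a fixed-point-free involution.
matching-fpf : ∀ {m} (σ : Permutation′ m) → IsFPFInvolution (matching σ)
matching-fpf {m} σ = involutive , no-fixed-point
  where
  open ≡-Reasoning
  involutive : ∀ x → matching σ (matching σ x) ≡ x
  involutive x = begin
    join m m (cross σ (splitAt m (join m m (cross σ (splitAt m x)))))
      ≡⟨ cong (join m m ∘ cross σ) (splitAt-join m m (cross σ (splitAt m x))) ⟩
    join m m (cross σ (cross σ (splitAt m x)))
      ≡⟨ cong (join m m) (cross-involutive σ (splitAt m x)) ⟩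
    join m m (splitAt m x)
      ≡⟨ join-splitAt m m x ⟩
    x ∎
  no-fixed-point : ∀ x → matching σ x ≢ x
  no-fixed-point x e = cross-no-fixed-point σ (splitAt m x)
    (trans (sym (splitAt-join m m (cross σ (splitAt m x)))) (cong (splitAt m) e))

matching-injective : ∀ {m} (σ τ : Permutation′ m) → (∀ x → matching σ x ≡ matching τ x) →
  ∀ p → σ ⟨$⟩ʳ p ≡ τ ⟨$⟩ʳ p
matching-injective {m} σ τ e p = ↑ʳ-injective m _ _ (begin
  m ↑ʳ (σ ⟨$⟩ʳ p)          ≡⟨ cong (join m m ∘ cross σ) (splitAt-↑ˡ m p m) ⟨
  matching σ (p ↑ˡ m)      ≡⟨ e (p ↑ˡ m) ⟩
  matching τ (p ↑ˡ m)      ≡⟨ cong (join m m ∘ cross τ) (splitAt-↑ˡ m p m) ⟩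
  m ↑ʳ (τ ⟨$⟩ʳ p)          ∎)
  where open ≡-Reasoning

-- Lehmer codes: a code of length k picks some c_j ≤ j for every j < k.
LehmerCode : ℕ → Set
LehmerCode zero    = ⊤
LehmerCode (suc k) = Fin (suc k) × LehmerCode k

allLehmerCodes : ∀ k → List (LehmerCode k)
allLehmerCodes zero    = tt ∷ []
allLehmerCodes (suc k) = cartesianProduct (allFin (suc k)) (allLehmerCodes k)

allLehmerCodes-length : ∀ k → length (allLehmerCodes k) ≡ k !
allLehmerCodes-length zero    = refl
allLehmerCodes-length (suc k) =
  trans (length-cartesianProductWith _,_ (allFin (suc k)) (allLehmerCodes k))
        (cong₂ _*_ (length-tabulate {n = suc k} (λ i → i)) (allLehmerCodes-length k))

allLehmerCodes-unique : ∀ k → Unique (allLehmerCodes k)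
allLehmerCodes-unique zero    = All.[] ∷ []
allLehmerCodes-unique (suc k) =
  Unique.cartesianProduct⁺ (Unique.allFin⁺ (suc k)) (allLehmerCodes-unique k)

decode : ∀ {m k} → k ≤ m → LehmerCode k → Permutation′ m
decode {k = zero}  _   tt       = idₚ
decode {k = suc k} k<m (c , cs) = decode (<⇒≤ k<m) cs ∘ₚ transpose (fromℕ< k<m) (inject≤ c k<m)

decode-fixes : ∀ {m k} (k≤m : k ≤ m) cs p → k ≤ toℕ p → decode k≤m cs ⟨$⟩ʳ p ≡ p
decode-fixes {k = zero}  _   tt       p _   = refl
decode-fixes {k = suc k} k<m (c , cs) p k<p =
  trans (cong (transpose (fromℕ< k<m) (inject≤ c k<m) ⟨$⟩ʳ_) (decode-fixes (<⇒≤ k<m) cs p (<⇒≤ k<p)))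
        (transpose-elsewhere p≢k p≢c)
  where
  p≢k : p ≢ fromℕ< k<m
  p≢k p≡k = <-irrefl (sym (trans (cong toℕ p≡k) (toℕ-fromℕ< k<m))) k<p
  p≢c : p ≢ inject≤ c k<m
  p≢c p≡c = <⇒≱ k<p
    (subst (_≤ k) (sym (trans (cong toℕ p≡c) (toℕ-inject≤ c k<m))) (≤-pred (toℕ<n c)))

decode-last : ∀ {m k} (k<m : suc k ≤ m) c cs → decode k<m (c , cs) ⟨$⟩ʳ fromℕ< k<m ≡ inject≤ c k<m
decode-last k<m c cs =
  trans (cong (transpose (fromℕ< k<m) (inject≤ c k<m) ⟨$⟩ʳ_)
              (decode-fixes (<⇒≤ k<m) cs (fromℕ< k<m) (≤-reflexive (sym (toℕ-fromℕ< k<m)))))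
        (transpose-at (fromℕ< k<m) (inject≤ c k<m))

-- Decoding is injective: read off c_k, then undo its transposition.
decode-injective : ∀ {m k} (k≤m : k ≤ m) cs cs′ →
  (∀ p → decode k≤m cs ⟨$⟩ʳ p ≡ decode k≤m cs′ ⟨$⟩ʳ p) → cs ≡ cs′
decode-injective {k = zero}  _   tt tt _ = refl
decode-injective {k = suc k} k<m (c , cs) (c′ , cs′) same
  with inject≤-injective k<m k<m c c′
         (trans (sym (decode-last k<m c cs)) (trans (same (fromℕ< k<m)) (decode-last k<m c′ cs′)))
... | refl = cong (c ,_) (decode-injective (<⇒≤ k<m) cs cs′ λ p → begin
  decode (<⇒≤ k<m) cs ⟨$⟩ʳ p                  ≡⟨ inverseˡ swap ⟨
  swap ⟨$⟩ˡ (decode k<m (c , cs) ⟨$⟩ʳ p)      ≡⟨ cong (swap ⟨$⟩ˡ_) (same p) ⟩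
  swap ⟨$⟩ˡ (decode k<m (c , cs′) ⟨$⟩ʳ p)     ≡⟨ inverseˡ swap ⟩
  decode (<⇒≤ k<m) cs′ ⟨$⟩ʳ p                 ∎)
  where
  open ≡-Reasoning
  swap : Permutation′ _
  swap = transpose (fromℕ< k<m) (inject≤ c k<m)

factorial≤#fpfInvolutions : ∀ m → m ! ≤ length (fpfInvolutions (m + m))
factorial≤#fpfInvolutions m = subst (_≤ length (fpfInvolutions (m + m)))
  (trans (length-map table (allLehmerCodes m)) (allLehmerCodes-length m))
  (count-by-family (map table (allLehmerCodes m))
    (Unique.map⁺ table-injective (allLehmerCodes-unique m))
    (All.map⁺ (All.universal table-fpf (allLehmerCodes m))))
  where
  table : LehmerCode m → Vec (Fin (m + m)) (m + m)
  table cs = tabulate (matching (decode ≤-refl cs))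
  table-fpf : ∀ cs → IsFPFInvolution (lookup (table cs))
  table-fpf cs = fpf-resp-≗ (λ x → sym (lookup∘tabulate _ x)) (matching-fpf (decode ≤-refl cs))
  table-injective : ∀ {cs cs′} → table cs ≡ table cs′ → cs ≡ cs′
  table-injective {cs} {cs′} e = decode-injective ≤-refl cs cs′ (matching-injective _ _ λ x → begin
    matching (decode ≤-refl cs) x  ≡⟨ lookup∘tabulate _ x ⟨
    lookup (table cs) x            ≡⟨ cong (λ v → lookup v x) e ⟩
    lookup (table cs′) x           ≡⟨ lookup∘tabulate _ x ⟩
    matching (decode ≤-refl cs′) x ∎)
    where open ≡-Reasoning

bernoulli : ∀ m j d → j + d ≡ suc m → suc m ^ j * d ≤ m ^ j * suc m
bernoulli m zero    d refl = ≤-refl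
bernoulli m (suc j) d j+d≡m = begin
  suc m * suc m ^ j * d       ≡⟨ regroup (suc m) (suc m ^ j) d ⟩
  suc m ^ j * (d + m * d)     ≤⟨ *-monoʳ-≤ (suc m ^ j) (+-monoˡ-≤ (m * d) d≤m) ⟩
  suc m ^ j * (m + m * d)     ≡⟨ regroup′ (suc m ^ j) m d ⟩
  m * (suc m ^ j * suc d)     ≤⟨ *-monoʳ-≤ m (bernoulli m j (suc d) (trans (+-suc j d) j+d≡m)) ⟩
  m * (m ^ j * suc m)         ≡⟨ *-assoc m (m ^ j) (suc m) ⟨
  m * m ^ j * suc m           ∎
  where
  open ≤-Reasoning
  d≤m : d ≤ m
  d≤m = subst (d ≤_) (suc-injective j+d≡m) (m≤n+m d j)
  regroup : ∀ a b d → a * b * d ≡ b * (a * d)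
  regroup = solve-∀
  regroup′ : ∀ a m d → a * (m + m * d) ≡ m * (a * (1 + d))
  regroup′ = solve-∀

half-power : ∀ m j d → j + d ≡ suc m → j ≤ d → suc m ^ j ≤ 2 * m ^ j
half-power m j zero    j+0≡m+1 z≤n = ⊥-elim (0≢1+n j+0≡m+1)
half-power m j (suc d) j+d≡m+1 j≤d = *-cancelʳ-≤ (suc m ^ j) (2 * m ^ j) (suc d) (begin
  suc m ^ j * suc d           ≤⟨ bernoulli m j (suc d) j+d≡m+1 ⟩
  m ^ j * suc m               ≡⟨ cong (m ^ j *_) (sym j+d≡m+1) ⟩
  m ^ j * (j + suc d)         ≤⟨ *-monoʳ-≤ (m ^ j) (+-monoˡ-≤ (suc d) j≤d) ⟩
  m ^ j * (suc d + suc d)     ≡⟨ regroup (m ^ j) (suc d) ⟩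
  2 * m ^ j * suc d           ∎)
  where
  open ≤-Reasoning
  regroup : ∀ a d → a * (d + d) ≡ 2 * a * d
  regroup = solve-∀

-- (1 + 1/m)^m ≤ 4: split the exponent into halves ⌊m/2⌋ + ⌈m/2⌉.
succ-power≤ : ∀ m → suc m ^ m ≤ 4 * m ^ m
succ-power≤ m = begin
  suc m ^ m                       ≡⟨ cong (suc m ^_) (sym halves) ⟩
  suc m ^ (a + b)                 ≡⟨ ^-distribˡ-+-* (suc m) a b ⟩
  suc m ^ a * suc m ^ b           ≤⟨ *-mono-≤ (half-power m a (suc b) a+b+1 a≤b+1)
                                              (half-power m b (suc a) b+a+1 b≤a+1) ⟩
  2 * m ^ a * (2 * m ^ b)         ≡⟨ regroup (m ^ a) (m ^ b) ⟩
  4 * (m ^ a * m ^ b)             ≡⟨ cong (4 *_) (^-distribˡ-+-* m a b) ⟨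
  4 * m ^ (a + b)                 ≡⟨ cong (λ e → 4 * m ^ e) halves ⟩
  4 * m ^ m                       ∎
  where
  open ≤-Reasoning
  a = ⌊ m /2⌋
  b = ⌈ m /2⌉
  halves : a + b ≡ m
  halves = ⌊n/2⌋+⌈n/2⌉≡n m
  a+b+1 : a + suc b ≡ suc m
  a+b+1 = trans (+-suc a b) (cong suc halves)
  b+a+1 : b + suc a ≡ suc m
  b+a+1 = trans (+-suc b a) (cong suc (trans (+-comm b a) halves))
  a≤b+1 : a ≤ suc b
  a≤b+1 = m≤n⇒m≤1+n (⌊n/2⌋≤⌈n/2⌉ m)
  b≤a+1 : b ≤ suc a
  b≤a+1 = ⌊n/2⌋-mono (n≤1+n (suc m))
  regroup : ∀ x y → 2 * x * (2 * y) ≡ 4 * (x * y)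
  regroup = solve-∀

power≤factorial : ∀ m → m ^ m ≤ 4 ^ m * m !
power≤factorial zero    = ≤-refl
power≤factorial (suc m) = begin
  suc m * suc m ^ m             ≤⟨ *-monoʳ-≤ (suc m) (succ-power≤ m) ⟩
  suc m * (4 * m ^ m)           ≤⟨ *-monoʳ-≤ (suc m) (*-monoʳ-≤ 4 (power≤factorial m)) ⟩
  suc m * (4 * (4 ^ m * m !))   ≡⟨ regroup (suc m) (4 ^ m) (m !) ⟩
  4 * 4 ^ m * (suc m * m !)     ∎
  where
  open ≤-Reasoning
  regroup : ∀ a b c → a * (4 * (b * c)) ≡ 4 * b * (a * c)
  regroup = solve-∀

double≤power : ∀ m → m + m ≤ 4 ^ m
double≤power zero    = z≤n
double≤power (suc m) = begin
  suc m + suc m                          ≡⟨ cong suc (+-suc m m) ⟩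
  1 + (1 + (m + m))                      ≤⟨ +-mono-≤ one≤ (+-mono-≤ one≤ (double≤power m)) ⟩
  4 ^ m + (4 ^ m + 4 ^ m)                ≤⟨ +-monoʳ-≤ (4 ^ m) (+-monoʳ-≤ (4 ^ m) (m≤m+n (4 ^ m) _)) ⟩
  4 ^ m + (4 ^ m + (4 ^ m + (4 ^ m + 0))) ∎
  where
  open ≤-Reasoning
  one≤ : 1 ≤ 4 ^ m
  one≤ = m^n>0 4 m

thirty-two-power : ∀ w m →
  (32 * w) ^ m * (32 * w) ^ m ≡ 4 ^ m * (4 ^ m * (4 ^ m * (4 ^ m * 4 ^ m))) * (w ^ m * w ^ m)
thirty-two-power w zero    = refl
thirty-two-power w (suc m) = begin
  32 * w * X * (32 * w * X)                 ≡⟨ square w X ⟩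
  1024 * (w * w) * (X * X)                  ≡⟨ cong (1024 * (w * w) *_) (thirty-two-power w m) ⟩
  1024 * (w * w) * (A * (A * (A * (A * A))) * (W * W))
                                            ≡⟨ regroup w A W ⟩
  4 * A * (4 * A * (4 * A * (4 * A * (4 * A)))) * (w * W * (w * W)) ∎
  where
  open ≡-Reasoning
  X = (32 * w) ^ m
  A = 4 ^ m
  W = w ^ m
  square : ∀ w x → 32 * w * x * (32 * w * x) ≡ 1024 * (w * w) * (x * x)
  square = solve-∀
  regroup : ∀ w a v → 1024 * (w * w) * (a * (a * (a * (a * a))) * (v * v)) ≡
                      4 * a * (4 * a * (4 * a * (4 * a * (4 * a)))) * (w * v * (w * v))
  regroup = solve-∀

-- The final estimate: for 32 w ≤ m, 2m · 4^(2m) · w^(2m) ≤ (m!)², via (32 w)^m ≤ m^m ≤ 4^m m!.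
counting-estimate : ∀ m w → 32 * w ≤ m → (m + m) * (4 ^ (m + m) * w ^ (m + m)) ≤ m ! * m !
counting-estimate m w 32w≤m = *-cancelˡ-≤ (4 ^ (m + m)) {{m^n≢0 4 (m + m)}} (begin
  4 ^ (m + m) * ((m + m) * (4 ^ (m + m) * w ^ (m + m)))
      ≡⟨ cong₂ (λ x y → x * ((m + m) * (x * y))) (^-distribˡ-+-* 4 m m) (^-distribˡ-+-* w m m) ⟩
  A * A * ((m + m) * (A * A * (W * W)))
      ≤⟨ *-monoʳ-≤ (A * A) (*-monoˡ-≤ (A * A * (W * W)) (double≤power m)) ⟩
  A * A * (A * (A * A * (W * W)))        ≡⟨ regroup A W ⟩
  A * (A * (A * (A * A))) * (W * W)      ≡⟨ thirty-two-power w m ⟨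
  (32 * w) ^ m * (32 * w) ^ m            ≤⟨ *-mono-≤ (^-monoˡ-≤ m 32w≤m) (^-monoˡ-≤ m 32w≤m) ⟩
  m ^ m * m ^ m                          ≤⟨ *-mono-≤ (power≤factorial m) (power≤factorial m) ⟩
  A * m ! * (A * m !)                    ≡⟨ regroup′ A (m !) ⟩
  A * A * (m ! * m !)                    ≡⟨ cong (_* (m ! * m !)) (^-distribˡ-+-* 4 m m) ⟨
  4 ^ (m + m) * (m ! * m !)              ∎)
  where
  open ≤-Reasoning
  A = 4 ^ m
  W = w ^ m
  regroup : ∀ a v → a * a * (a * (a * a * (v * v))) ≡ a * (a * (a * (a * a))) * (v * v)
  regroup = solve-∀
  regroup′ : ∀ a f → a * f * (a * f) ≡ a * a * (f * f)
  regroup′ = solve-∀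

small-cut≤width : ∀ n c → 64 * c < 1 * n → c ≤ n / 64
small-cut≤width n c 64c<n = subst (_≤ n / 64) (m*n/n≡m c 64)
  (/-monoˡ-≤ 64 (subst (_≤ n) (*-comm 64 c) (subst (64 * c ≤_) (+-identityʳ n) (<⇒≤ 64c<n))))

width≤half : ∀ m → 32 * ((m + m) / 64) ≤ m
width≤half m = *-cancelˡ-≤ 2
  (subst₂ _≤_ (regroup ((m + m) / 64)) (cong (m +_) (sym (+-identityʳ m))) (m/n*n≤m (m + m) 64))
  where
  regroup : ∀ w → w * 64 ≡ 2 * (32 * w)
  regroup = solve-∀

square : ∀ x → x ^ 2 ≡ x * x
square x = cong (x *_) (*-identityʳ x)

-- The inequality of the theorem for the constant c = 1/64 (p = 1, q = 64).
SmallCutBound : ℕ → Set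
SmallCutBound n =
  n * length (filter (λ π → 64 * cut π <? 1 * n) (fpfInvolutions n)) ^ 2 ≤ length (fpfInvolutions n) ^ 2

small-cut-estimate : ∀ m → SmallCutBound (m + m)
small-cut-estimate m = begin
  n * bad ^ 2                         ≡⟨ cong (n *_) (square bad) ⟩
  n * (bad * bad)                     ≤⟨ *-monoʳ-≤ n (*-mono-≤ bad≤#dyck bad≤#dyck) ⟩
  n * (#dyck w n 0 * #dyck w n 0)     ≤⟨ *-monoʳ-≤ n (#dyck-bound w n 0) ⟩
  n * (4 ^ n * w ^ (n + 0))           ≡⟨ cong (λ e → n * (4 ^ n * w ^ e)) (+-identityʳ n) ⟩
  n * (4 ^ n * w ^ n)                 ≤⟨ counting-estimate m w (width≤half m) ⟩
  m ! * m !                           ≤⟨ *-mono-≤ (factorial≤#fpfInvolutions m)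
                                                   (factorial≤#fpfInvolutions m) ⟩
  total * total                       ≡⟨ square total ⟨
  total ^ 2                           ∎
  where
  open ≤-Reasoning
  n = m + m
  w = n / 64
  bad = length (filter (λ π → 64 * cut π <? 1 * n) (fpfInvolutions n))
  total = length (fpfInvolutions n)
  bad≤#dyck : bad ≤ #dyck w n 0
  bad≤#dyck = count-by-encoding {n} (λ π → 64 * cut π <? 1 * n) encode (dyckWords w n 0)
    (λ fπ fσ e → code-injective fπ fσ (encode-letters _ _ e))
    (λ {π} fπ small → encode-dyck fπ (small-cut≤width n (cut π) small))

corollary3 : Σ ℕ λ p → Σ ℕ λ q → Σ ℕ λ N →
    0 < p × 0 < q ×
    ((n : ℕ) → 2 ∣ n → N ≤ n →
    n * length (filter (λ π → q * cut π <? p * n) (fpfInvolutions n)) ^ 2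
    ≤ length (fpfInvolutions n) ^ 2)
corollary3 = 1 , 64 , 0 , z<s , z<s , λ { n (divides m refl) _ →
  subst SmallCutBound (trans (cong (m +_) (sym (+-identityʳ m))) (*-comm 2 m)) (small-cut-estimate m) }
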